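{- Let $P=[x_1,\ldots,x_\ell]\,[y_1,\ldots,y_r]_n$ be a Simple Chopsticks position with $\ell<r$, and suppose Left moves first. If Left has a winning strategy from $P$, then $\ell=r-1$, and every winning first move for Left is a move that removes one of Right's hands (i.e. a move $x_i$ onto $y_j$ with $x_i+y_j>n$).
   Context: Simple Chopsticks. Fix a positive integer $n$, the finger count. A position $[x_1,\ldots,x_\ell]\,[y_1,\ldots,y_r]_n$ consists of a finite non-decreasing sequence $(x_1,\ldots,x_\ell)$ of integers in $\{1,\ldots,n\}$ (Left's hands) and a finite non-decreasing sequence $(y_1,\ldots,y_r)$ of integers in $\{1,\ldots,n\}$ (Right's hands); either list may be empty. Left's moves: for any $i\in\{1,\ldots,\ell\}$, $j\in\{1,\ldots,r\}$, replace $y_j$ by $y_j+x_i$ (re-sorting), removing the entry from Right's list if $y_j+x_i>n$. Right's moves: for any $i,j$, replace $x_i$ by $x_i+y_j$, removing it if $x_i+y_j>n$. No moves are available when either list is empty. Normal play: a player who cannot move on their turn loses. -}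

module Defs where

open import Data.Nat using (ℕ; zero; suc; _+_; _≤_; _<_; _<ᵇ_; _≤ᵇ_)
open import Data.Bool using (if_then_else_)
open import Data.List using (List; []; _∷_; length; lookup; removeAt)
open import Data.Fin using (Fin)
open import Data.Product using (_×_)

-- A position [x₁..x_ℓ][y₁..y_r]ₙ is represented by the finger count n and
-- two lists of naturals (Left's hands, Right's hands).  Validity (entries in
-- {1..n}, non-decreasing) is imposed as a hypothesis in the statement.

ins : ℕ → List ℕ → List ℕ
ins a [] = a ∷ []
ins a (b ∷ bs) = if a ≤ᵇ b then a ∷ b ∷ bs else b ∷ ins a bs

hit : ℕ → ℕ → (ys : List ℕ) → Fin (length ys) → List ℕ
hit n a ys j =
  if n <ᵇ (a + lookup ys j) then removeAt ys j else ins (a + lookup ys j) (removeAt ys j)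

leftMove : ℕ → (xs ys : List ℕ) → Fin (length xs) → Fin (length ys) → List ℕ
leftMove n xs ys i j = hit n (lookup xs i) ys j

rightMove : ℕ → (xs ys : List ℕ) → Fin (length xs) → Fin (length ys) → List ℕ
rightMove n xs ys i j = hit n (lookup ys j) xs i

-- Normal play outcome, defined inductively (the game is finite, so an
-- inductive witness is exactly a winning strategy).
-- If no move exists (either list empty), RightLoses holds vacuously and
-- LeftWins has no constructor instance.
data LeftWins (n : ℕ) (xs ys : List ℕ) : Set
data RightLoses (n : ℕ) (xs ys : List ℕ) : Set

data LeftWins n xs ys where
  leftWin : (i : Fin (length xs)) (j : Fin (length ys)) →
            RightLoses n xs (leftMove n xs ys i j) → LeftWins n xs ys

data RightLoses n xs ys where
  rightLose : ((i : Fin (length xs)) (j : Fin (length ys)) →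
               LeftWins n (rightMove n xs ys i j) ys) → RightLoses n xs ys

InRange : ℕ → ℕ → Set
InRange n x = (1 ≤ x) × (x ≤ n)

-- The heart of the argument is that a player to move who has more hands than a
-- nonempty opponent never loses.  It is proved by simultaneous induction on
-- game derivations, together with two facts about a winning mover: it faces
-- at most one extra hand, and none at all if no hand of its can remove one of
-- the opponent's.  With exactly one extra hand and no removal available, the
-- mover either combines its two smallest hands safely, or combines its two
-- largest into a hand that can remove and be removed by everything, which the
-- opponent cannot exploit.  Applied to Left's first move: a non-removing move
-- leaves Right to move with more hands than Left, and even a removing one does
-- so unless r = ℓ + 1.

module Submission where

open import Defs
open import Data.Bool using (true; false; if_then_else_)
open import Data.Fin using (Fin; zero; suc; cast)
open import Data.Fin.Properties using (nonZeroIndex)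
open import Data.List using (List; []; _∷_; length; lookup; removeAt)
open import Data.List.Membership.Propositional using (_∈_)
open import Data.List.Membership.Propositional.Properties using (∈-lookup)
open import Data.List.Properties using (length-removeAt′)
open import Data.List.Relation.Binary.Subset.Propositional using (_⊆_)
open import Data.List.Relation.Unary.All using (All)
open import Data.List.Relation.Unary.Any using (here; there)
open import Data.List.Relation.Unary.Linked using (Linked)
open import Data.Nat using (ℕ; suc; _+_; _<_; _≤_; _≮_; _≤ᵇ_; _<?_; _≤?_; s≤s; >-nonZero⁻¹)
open import Data.Nat.Properties
open import Data.Product using (_×_; _,_; ∃; ∃₂)
open import Data.Sum using (_⊎_; inj₁; inj₂)
open import Function using (_∘_)
open import Relation.Binary.Core using (Rel)
open import Relation.Binary.Definitions using (Reflexive; Transitive; Total)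
import Relation.Binary.Construct.Flip.Ord as Flip
open import Relation.Binary.PropositionalEquality using (_≡_; refl; sym; trans; cong; subst)
open import Relation.Nullary using (¬_; yes; no; contradiction)
open import Relation.Nullary.Reflects using (Reflects; ofʸ; ofⁿ)
open import Algebra.Properties.CommutativeSemigroup +-commutativeSemigroup using (x∙yz≈y∙xz)

module _ {a ℓ} {A : Set a} {_≼_ : Rel A ℓ}
         (≼-refl : Reflexive _≼_) (≼-trans : Transitive _≼_) (≼-total : Total _≼_) where

  greatestIndex : ∀ x xs → ∃ λ i → ∀ {z} → z ∈ x ∷ xs → z ≼ lookup (x ∷ xs) i
  greatestIndex x [] = zero , λ { (here refl) → ≼-refl }
  greatestIndex x (y ∷ ys) with greatestIndex y ys
  ... | i , greatest with ≼-total x (lookup (y ∷ ys) i)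
  ... | inj₁ x≼ = suc i , λ { (here refl) → x≼ ; (there z∈) → greatest z∈ }
  ... | inj₂ ≼x = zero , λ { (here refl) → ≼-refl ; (there z∈) → ≼-trans (greatest z∈) ≼x }

maxIndex : ∀ x xs → ∃ λ i → ∀ {z} → z ∈ x ∷ xs → z ≤ lookup (x ∷ xs) i
maxIndex = greatestIndex ≤-refl ≤-trans ≤-total

minIndex : ∀ x xs → ∃ λ i → ∀ {z} → z ∈ x ∷ xs → lookup (x ∷ xs) i ≤ z
minIndex = greatestIndex ≤-refl (Flip.transitive _≤_ ≤-trans) (Flip.total _≤_ ≤-total)

removeAt-⊆ : ∀ {a} {A : Set a} (xs : List A) k → removeAt xs k ⊆ xs
removeAt-⊆ (x ∷ xs) zero    z∈       = there z∈
removeAt-⊆ (x ∷ xs) (suc k) (here e)  = here e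
removeAt-⊆ (x ∷ xs) (suc k) (there z∈) = there (removeAt-⊆ xs k z∈)

length-ins : ∀ v R → length (ins v R) ≡ suc (length R)
length-ins v [] = refl
length-ins v (b ∷ bs) with v ≤ᵇ b
... | true  = refl
... | false = cong suc (length-ins v bs)

∈-ins⁻ : ∀ v R {z} → z ∈ ins v R → z ≡ v ⊎ z ∈ R
∈-ins⁻ v [] (here e) = inj₁ e
∈-ins⁻ v (b ∷ bs) z∈ with v ≤ᵇ b | z∈
... | true  | here e    = inj₁ e
... | true  | there z∈′ = inj₂ z∈′
... | false | here e    = inj₂ (here e)
... | false | there z∈′ with ∈-ins⁻ v bs z∈′
...   | inj₁ e   = inj₁ e
...   | inj₂ z∈R = inj₂ (there z∈R)

removeAt-ins-⊆ : ∀ v R k → lookup (ins v R) k ≡ v → removeAt (ins v R) k ⊆ R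
removeAt-ins-⊆ v [] zero e ()
removeAt-ins-⊆ v (b ∷ bs) k e z∈ with v ≤ᵇ b | k | z∈
... | true  | zero  | z∈′        = z∈′
-- position k held another copy of v, so the surviving inserted v lies in R
... | true  | suc k′ | here z≡v  = subst (_∈ b ∷ bs) (trans e (sym z≡v)) (∈-lookup k′)
... | true  | suc k′ | there z∈′ = removeAt-⊆ (b ∷ bs) k′ z∈′
... | false | zero  | z∈′ with ∈-ins⁻ v bs z∈′
...   | inj₁ z≡v = here (trans z≡v (sym e))
...   | inj₂ z∈R = there z∈R
removeAt-ins-⊆ v (b ∷ bs) k e z∈ | false | suc k′ | here z≡b  = here z≡b
removeAt-ins-⊆ v (b ∷ bs) k e z∈ | false | suc k′ | there z∈′ = there (removeAt-ins-⊆ v bs k′ e z∈′)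

data HitView (n a : ℕ) (ys : List ℕ) (j : Fin (length ys)) : List ℕ → Set where
  removes : n < a + lookup ys j → HitView n a ys j (removeAt ys j)
  keeps   : a + lookup ys j ≤ n → HitView n a ys j (ins (a + lookup ys j) (removeAt ys j))

hitView : ∀ n a ys j → HitView n a ys j (hit n a ys j)
hitView n a ys j = view (<ᵇ-reflects-< n (a + lookup ys j))
  where
  view : ∀ {b} → Reflects (n < a + lookup ys j) b →
         HitView n a ys j (if b then removeAt ys j else ins (a + lookup ys j) (removeAt ys j))
  view (ofʸ n<s) = removes n<s
  view (ofⁿ n≮s) = keeps (≮⇒≥ n≮s)

module _ (n a : ℕ) (ys : List ℕ) (j : Fin (length ys)) where

  hit-removes : n < a + lookup ys j → hit n a ys j ≡ removeAt ys j
  hit-removes n<s with hit n a ys j | hitView n a ys j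
  ... | _ | removes _ = refl
  ... | _ | keeps s≤n = contradiction s≤n (<⇒≱ n<s)

  length-hit-removes : n < a + lookup ys j → suc (length (hit n a ys j)) ≡ length ys
  length-hit-removes n<s = trans (cong (suc ∘ length) (hit-removes n<s)) (sym (length-removeAt′ ys j))

  length-hit-keeps : a + lookup ys j ≤ n → length (hit n a ys j) ≡ length ys
  length-hit-keeps s≤n with hit n a ys j | hitView n a ys j
  ... | _ | removes n<s = contradiction s≤n (<⇒≱ n<s)
  ... | _ | keeps _     = trans (length-ins (a + lookup ys j) (removeAt ys j)) (sym (length-removeAt′ ys j))

  length-hit≤ : length (hit n a ys j) ≤ length ys
  length-hit≤ with n <? a + lookup ys j
  ... | yes n<s = m+n≤o⇒n≤o 1 (≤-reflexive (length-hit-removes n<s))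
  ... | no  n≮s = ≤-reflexive (length-hit-keeps (≮⇒≥ n≮s))

  length≤suc-length-hit : length ys ≤ suc (length (hit n a ys j))
  length≤suc-length-hit with n <? a + lookup ys j
  ... | yes n<s = ≤-reflexive (sym (length-hit-removes n<s))
  ... | no  n≮s = ≤-trans (≤-reflexive (sym (length-hit-keeps (≮⇒≥ n≮s)))) (n≤1+n _)

  ∈-hit⁻ : ∀ {z} → z ∈ hit n a ys j → z ≡ a + lookup ys j ⊎ z ∈ ys
  ∈-hit⁻ z∈ with hit n a ys j | hitView n a ys j
  ... | _ | removes _ = inj₂ (removeAt-⊆ ys j z∈)
  ... | _ | keeps _ with ∈-ins⁻ _ _ z∈
  ...   | inj₁ z≡s = inj₁ z≡s
  ...   | inj₂ z∈R = inj₂ (removeAt-⊆ ys j z∈R)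

  hit-removes-⊆ : n < a + lookup ys j → hit n a ys j ⊆ ys
  hit-removes-⊆ n<s z∈ = removeAt-⊆ ys j (subst (_ ∈_) (hit-removes n<s) z∈)

  removeAt-hit-keeps-⊆ : a + lookup ys j ≤ n → (k : Fin (length (hit n a ys j))) →
                         lookup (hit n a ys j) k ≡ a + lookup ys j → removeAt (hit n a ys j) k ⊆ ys
  removeAt-hit-keeps-⊆ s≤n with hit n a ys j | hitView n a ys j
  ... | _ | removes n<s = contradiction s≤n (<⇒≱ n<s)
  ... | _ | keeps _     = λ k e z∈ → removeAt-⊆ ys j (removeAt-ins-⊆ _ _ k e z∈)

-- The first list holds the hands of the player to move; dropping the names
-- Left and Right makes the game symmetric.
data MoverWins (n : ℕ) (A B : List ℕ) : Set
data MoverLoses (n : ℕ) (A B : List ℕ) : Set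

data MoverWins n A B where
  wins : (i : Fin (length A)) (j : Fin (length B)) →
         MoverLoses n (hit n (lookup A i) B j) A → MoverWins n A B

data MoverLoses n A B where
  loses : ((i : Fin (length A)) (j : Fin (length B)) →
           MoverWins n (hit n (lookup A i) B j) A) → MoverLoses n A B

leftWins⇒moverWins : ∀ {n xs ys} → LeftWins n xs ys → MoverWins n xs ys
rightLoses⇒moverLoses : ∀ {n xs ys} → RightLoses n xs ys → MoverLoses n ys xs
leftWins⇒moverWins (leftWin i j lost) = wins i j (rightLoses⇒moverLoses lost)
rightLoses⇒moverLoses (rightLose f) = loses λ j i → leftWins⇒moverWins (f i j)

NoRemoval : ℕ → List ℕ → List ℕ → Set
NoRemoval n A B = ∀ {a b} → a ∈ A → b ∈ B → a + b ≤ n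

NoRemoval-sym : ∀ {n A B} → NoRemoval n A B → NoRemoval n B A
NoRemoval-sym {n} noRem {b} {a} b∈ a∈ = subst (_≤ n) (+-comm a b) (noRem a∈ b∈)

NoRemoval-⊆ : ∀ {n A A′ B B′} → A′ ⊆ A → B′ ⊆ B → NoRemoval n A B → NoRemoval n A′ B′
NoRemoval-⊆ A′⊆A B′⊆B noRem a∈ b∈ = noRem (A′⊆A a∈) (B′⊆B b∈)

NoRemoval-hit : ∀ {n A B} x j → NoRemoval n A B → (∀ {a} → a ∈ A → a + (x + lookup B j) ≤ n) →
                NoRemoval n (hit n x B j) A
NoRemoval-hit {n} {B = B} x j noRem safe {z} {a} z∈ a∈ with ∈-hit⁻ n x B j z∈
... | inj₁ refl = subst (_≤ n) (+-comm a z) (safe a∈)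
... | inj₂ z∈B  = NoRemoval-sym noRem z∈B a∈

Deadly : ℕ → List ℕ → ℕ → Set
Deadly n A c = ∀ {a} → a ∈ A → n < a + c

removal⊎NoRemoval : ∀ n A B → (∃₂ λ i j → n < lookup A i + lookup B j) ⊎ NoRemoval n A B
removal⊎NoRemoval n [] B = inj₂ λ ()
removal⊎NoRemoval n (a ∷ as) [] = inj₂ λ _ ()
removal⊎NoRemoval n A@(a ∷ as) B@(b ∷ bs) with maxIndex a as | maxIndex b bs
... | iM , ≤aM | jM , ≤bM with n <? lookup A iM + lookup B jM
... | yes removal = inj₁ (iM , jM , removal)
... | no ¬removal = inj₂ λ a∈ b∈ → ≤-trans (+-mono-≤ (≤aM a∈) (≤bM b∈)) (≮⇒≥ ¬removal)

-- Either the smallest hands can be combined without creating a removal,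
-- or combining the largest hands creates a deadly one.
safeMove⊎deadlyMove : ∀ {n} a as b bs → NoRemoval n (a ∷ as) (b ∷ bs) →
  (∃₂ λ i j → NoRemoval n (hit n (lookup (a ∷ as) i) (b ∷ bs) j) (a ∷ as)) ⊎
  (∃₂ λ i j → Deadly n (a ∷ as) (lookup (a ∷ as) i + lookup (b ∷ bs) j))
safeMove⊎deadlyMove {n} a as b bs noRem
  with maxIndex a as | minIndex a as | minIndex b bs | maxIndex b bs
... | iM , ≤aM | im , am≤ | jm , bm≤ | jM , ≤bM
  with lookup (a ∷ as) iM + (lookup (a ∷ as) im + lookup (b ∷ bs) jm) ≤? n
... | yes safe   = inj₁ (im , jm , NoRemoval-hit _ jm noRem λ a∈ → ≤-trans (+-monoˡ-≤ _ (≤aM a∈)) safe)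
... | no  unsafe = inj₂ (iM , jM , λ {a′} a′∈ → <-≤-trans (≰⇒> unsafe) (begin
  aM + (am + bm) ≡⟨ x∙yz≈y∙xz aM am bm ⟩
  am + (aM + bm) ≤⟨ +-mono-≤ (am≤ a′∈) (+-monoʳ-≤ aM (bm≤ (∈-lookup jM))) ⟩
  a′ + (aM + bM) ∎))
  where
  open ≤-Reasoning
  aM = lookup (a ∷ as) iM
  am = lookup (a ∷ as) im
  bm = lookup (b ∷ bs) jm
  bM = lookup (b ∷ bs) jM

moverLoses⇒≮ : ∀ {n A B} → MoverLoses n A B → 0 < length B → length B ≮ length A
moverWins⇒≤suc : ∀ {n A B} → MoverWins n A B → length B ≤ suc (length A)
moverWins∧NoRemoval⇒≤ : ∀ {n A B} → MoverWins n A B → NoRemoval n A B → length B ≤ length A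
¬moverWins-afterDeadlyMove : ∀ {n A B} → NoRemoval n A B → length A ≡ suc (length B) →
  (i : Fin (length A)) (j : Fin (length B)) → Deadly n A (lookup A i + lookup B j) →
  ¬ MoverWins n (hit n (lookup A i) B j) A

moverLoses⇒≮ {n} {A@(a ∷ as)} {B@(b ∷ bs)} (loses f) _ |B|<|A|
  with suc (length B) <? length A
... | yes |B|+1<|A| = <⇒≱ |B|+1<|A| (begin
  length A                        ≤⟨ moverWins⇒≤suc (f zero zero) ⟩
  suc (length (hit n a B zero))   ≤⟨ s≤s (length-hit≤ n a B zero) ⟩
  suc (length B)                  ∎)
  where open ≤-Reasoning
... | no  |B|+1≮|A| with ≤-antisym (≮⇒≥ |B|+1≮|A|) |B|<|A| | removal⊎NoRemoval n A B
...   | |A|≡ | inj₁ (i , j , removal) = 1+n≰n (begin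
  suc (length B)                       ≡⟨ sym |A|≡ ⟩
  length A                             ≤⟨ moverWins⇒≤suc (f i j) ⟩
  suc (length (hit n (lookup A i) B j)) ≡⟨ length-hit-removes n (lookup A i) B j removal ⟩
  length B                             ∎)
  where open ≤-Reasoning
...   | |A|≡ | inj₂ noRem with safeMove⊎deadlyMove a as b bs noRem
...     | inj₁ (i , j , safe) = 1+n≰n (begin
  suc (length B)                   ≡⟨ sym |A|≡ ⟩
  length A                         ≤⟨ moverWins∧NoRemoval⇒≤ (f i j) safe ⟩
  length (hit n (lookup A i) B j)  ≡⟨ length-hit-keeps n (lookup A i) B j (noRem (∈-lookup i) (∈-lookup j)) ⟩
  length B                         ∎)
  where open ≤-Reasoning
...     | inj₂ (i , j , deadly) = ¬moverWins-afterDeadlyMove noRem |A|≡ i j deadly (f i j)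

moverWins⇒≤suc {n} {A} {B} (wins i j lost) = begin
  length B                                 ≤⟨ length≤suc-length-hit n (lookup A i) B j ⟩
  suc (length (hit n (lookup A i) B j))    ≤⟨ s≤s (≮⇒≥ (moverLoses⇒≮ lost (>-nonZero⁻¹ _ {{nonZeroIndex i}}))) ⟩
  suc (length A)                           ∎
  where open ≤-Reasoning

moverWins∧NoRemoval⇒≤ {n} {A} {B} (wins i j lost) noRem =
  subst (_≤ length A) (length-hit-keeps n (lookup A i) B j (noRem (∈-lookup i) (∈-lookup j)))
        (≮⇒≥ (moverLoses⇒≮ lost (>-nonZero⁻¹ _ {{nonZeroIndex i}})))

¬moverWins-afterDeadlyMove {n} {A} {B} noRem |A|≡ i j deadly (wins j′ i′ lost)
  with n <? lookup (hit n (lookup A i) B j) j′ + lookup A i′ | ∈-hit⁻ n (lookup A i) B j (∈-lookup j′)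
... | no ¬removal | _ = moverLoses⇒≮ lost (>-nonZero⁻¹ _ {{nonZeroIndex j′}}) (begin-strict
  length (hit n (lookup A i) B j) ≡⟨ length-hit-keeps n (lookup A i) B j (noRem (∈-lookup i) (∈-lookup j)) ⟩
  length B                        <⟨ n<1+n _ ⟩
  suc (length B)                  ≡⟨ sym |A|≡ ⟩
  length A                        ≡⟨ sym (length-hit-keeps n b′ A i′ (≮⇒≥ ¬removal)) ⟩
  length (hit n b′ A i′)          ∎)
  where
  open ≤-Reasoning
  b′ = lookup (hit n (lookup A i) B j) j′
... | yes removal | inj₂ b′∈B = <⇒≱ removal (subst (_≤ n) (+-comm (lookup A i′) _) (noRem (∈-lookup i′) b′∈B))
-- only the deadly hand can remove; removing it in turn leaves the mover one hand short with no removals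
... | yes removal | inj₁ b′≡c with lost
...   | loses g = 1+n≰n (begin
  suc (length B‴)  ≡⟨ length-hit-removes n a₀ B′ j′ removal₀ ⟩
  length B′        ≡⟨ length-hit-keeps n (lookup A i) B j keep ⟩
  length B         ≡⟨ |B|≡|A″| ⟩
  length A″        ≤⟨ moverWins∧NoRemoval⇒≤ (g i₀ j′) noRem‴ ⟩
  length B‴        ∎)
  where
  open ≤-Reasoning
  keep = noRem (∈-lookup i) (∈-lookup j)
  B′ = hit n (lookup A i) B j
  A″ = hit n (lookup B′ j′) A i′
  |B|≡|A″| : length B ≡ length A″
  |B|≡|A″| = suc-injective (trans (sym |A|≡) (sym (length-hit-removes n _ A i′ removal)))
  i₀ = cast |B|≡|A″| j
  a₀ = lookup A″ i₀
  removal₀ : n < a₀ + lookup B′ j′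
  removal₀ = subst (λ c → n < a₀ + c) (sym b′≡c) (deadly (hit-removes-⊆ n _ A i′ removal (∈-lookup i₀)))
  B‴ = hit n a₀ B′ j′
  B‴⊆B : B‴ ⊆ B
  B‴⊆B z∈ = removeAt-hit-keeps-⊆ n (lookup A i) B j keep j′ b′≡c (subst (_ ∈_) (hit-removes n a₀ B′ j′ removal₀) z∈)
  noRem‴ : NoRemoval n B‴ A″
  noRem‴ = NoRemoval-⊆ B‴⊆B (hit-removes-⊆ n _ A i′ removal) (NoRemoval-sym noRem)

lemma3p2 : (n : ℕ) → 1 ≤ n → (xs ys : List ℕ) →
    All (InRange n) xs → All (InRange n) ys →
    Linked _≤_ xs → Linked _≤_ ys →
    length xs < length ys →
    LeftWins n xs ys →
    (suc (length xs) ≡ length ys) ×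
    ((i : Fin (length xs)) (j : Fin (length ys)) →
      RightLoses n xs (leftMove n xs ys i j) →
      n < lookup xs i + lookup ys j)
-- the validity of the position (range and order of the entries) is not needed
lemma3p2 n _ xs ys _ _ _ _ |xs|<|ys| won =
  ≤-antisym |xs|<|ys| (moverWins⇒≤suc (leftWins⇒moverWins won)) , winningMove⇒removal
  where
  winningMove⇒removal : ∀ i j → RightLoses n xs (leftMove n xs ys i j) → n < lookup xs i + lookup ys j
  winningMove⇒removal i j lost with n <? lookup xs i + lookup ys j
  ... | yes removal = removal
  ... | no ¬removal = contradiction
    (subst (length xs <_) (sym (length-hit-keeps n (lookup xs i) ys j (≮⇒≥ ¬removal))) |xs|<|ys|)
    (moverLoses⇒≮ (rightLoses⇒moverLoses lost) (>-nonZero⁻¹ _ {{nonZeroIndex i}}))
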